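{- Let $\ell\ge 3$ and let $G$ be a simple graph with a proper edge-coloring containing no rainbow copy of $P_\ell$. If $v_1v_2\cdots v_\ell v_1$ is a rainbow copy of $C_\ell$ in $G$, then $d(v_i) \leq 2\ell - 3$ for every $1 \leq i \leq \ell$.
   Context: An edge-coloring is proper if any two edges sharing a vertex receive different colors. An edge-colored subgraph is rainbow if no two of its edges have the same color. $P_\ell$ denotes the path with $\ell$ edges ($\ell+1$ vertices), $C_\ell$ the cycle of length $\ell$, and $d(v)$ the degree of $v$ in $G$. -}

module Defs where

open import Data.Nat using (ℕ; zero; suc; _<_)
open import Data.Fin using (Fin; toℕ; inject₁) renaming (suc to fsuc)
open import Data.List using (length; filter)
open import Data.Fin.Base using () renaming (zero to fzero)
open import Data.Product using (Σ; _×_; _,_)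
open import Data.Empty using (⊥)
open import Relation.Nullary using (¬_; Dec)
open import Relation.Unary using (Decidable)
open import Relation.Binary.PropositionalEquality using (_≡_)
open import Function.Definitions using (Injective)
open import Data.List using (List)
import Data.List
open import Data.Sum using (_⊎_)
import Data.Fin as F

record SimpleGraph (n : ℕ) : Set₁ where
  field
    Adj     : Fin n → Fin n → Set
    adj?    : (u v : Fin n) → Dec (Adj u v)
    sym     : ∀ {u v} → Adj u v → Adj v u
    irrefl  : ∀ {u} → ¬ Adj u u
open SimpleGraph public

degree : ∀ {n} (G : SimpleGraph n) → Fin n → ℕ
degree {n} G v = length (filter (adj? G v) (Data.List.allFin n))

-- An edge-colouring: a colour for each ordered pair, required to be
-- symmetric on edges (so it is really a colouring of unordered edges).
-- Values on non-edges are irrelevant.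
record EdgeColoring {n : ℕ} (G : SimpleGraph n) : Set where
  field
    col    : Fin n → Fin n → ℕ
    col-sym : ∀ {u v} → Adj G u v → col u v ≡ col v u
open EdgeColoring public

Proper : ∀ {n} {G : SimpleGraph n} → EdgeColoring G → Set
Proper {n} {G} c = ∀ (u v w : Fin n) → Adj G u v → Adj G u w → ¬ (v ≡ w) →
  ¬ (col c u v ≡ col c u w)

-- a copy of the path P_ℓ (ℓ edges, ℓ+1 distinct vertices)
-- edge i (for i : Fin ℓ) joins p (inject₁ i) and p (suc i)
IsPath : ∀ {n} (G : SimpleGraph n) (ℓ : ℕ) → (Fin (suc ℓ) → Fin n) → Set
IsPath G ℓ p = Injective _≡_ _≡_ p × (∀ (i : Fin ℓ) → Adj G (p (inject₁ i)) (p (fsuc i)))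

RainbowPath : ∀ {n} {G : SimpleGraph n} (c : EdgeColoring G) (ℓ : ℕ) →
  (Fin (suc ℓ) → Fin n) → Set
RainbowPath {G = G} c ℓ p = IsPath G ℓ p ×
  (∀ (i j : Fin ℓ) → ¬ (i ≡ j) →
     ¬ (col c (p (inject₁ i)) (p (fsuc i)) ≡ col c (p (inject₁ j)) (p (fsuc j))))

NoRainbowPath : ∀ {n} {G : SimpleGraph n} (c : EdgeColoring G) (ℓ : ℕ) → Set
NoRainbowPath {n} c ℓ = ∀ (p : Fin (suc ℓ) → Fin n) → ¬ RainbowPath c ℓ p

IsNext : ∀ {ℓ} → Fin ℓ → Fin ℓ → Set
IsNext {ℓ} i j = (toℕ j ≡ suc (toℕ i)) ⊎ ((suc (toℕ i) ≡ ℓ) × (toℕ j ≡ 0))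

RainbowCycle : ∀ {n} {G : SimpleGraph n} (c : EdgeColoring G) (ℓ : ℕ) →
  (Fin ℓ → Fin n) → Set
RainbowCycle {G = G} c ℓ v =
  Injective _≡_ _≡_ v ×
  (∀ i j → IsNext i j → Adj G (v i) (v j)) ×
  (∀ i i' j j' → IsNext i i' → IsNext j j' → ¬ (i ≡ j) →
     ¬ (col c (v i) (v i') ≡ col c (v j) (v j')))

-- A neighbour w of v₀ off the cycle would extend the rainbow path v₀v₁⋯v_{ℓ-1}
-- to a rainbow P_ℓ, so the colour of wv₀ must repeat a colour of that path;
-- properness rules out the edge v₀v₁, leaving ℓ - 2 colours, and distinct such
-- neighbours carry distinct colours. Together with the ℓ - 1 neighbours on the
-- cycle this gives d(v₀) ≤ 2ℓ - 3, and rotating the cycle moves any vᵢ to v₀.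
module Submission where

open import Defs
open import Data.Nat using (ℕ; zero; suc; _≤_; _<_; _+_; _∸_; _*_; s≤s; _≟_)
open import Data.Nat.Properties
  using (<-irrefl; <-trans; n<1+n; 0≢1+n; suc-injective; +-suc; +-identityʳ; module ≤-Reasoning)
open import Data.Fin using (Fin; toℕ; inject₁; lower₁; join; splitAt) renaming (zero to fz; suc to fs)
open import Data.Fin.Properties
  using (toℕ-injective; toℕ<n; toℕ-inject₁; toℕ-lower₁; inject₁-injective; injective⇒≤; splitAt-join; any?)
  renaming (_≟_ to _≟ᶠ_)
open import Data.List using (List; lookup; filter; allFin)
import Data.List.Relation.Unary.All as All
open import Data.List.Relation.Unary.AllPairs using () renaming (_∷_ to _∷ᵃ_)
open import Data.List.Relation.Unary.Unique.Propositional using (Unique)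
open import Data.List.Relation.Unary.Unique.Propositional.Properties using (filter⁺; allFin⁺)
open import Data.List.Membership.Propositional.Properties using (∈-lookup; ∈-filter⁻)
open import Data.Vec.Functional using (_∷_)
open import Data.Product using (_,_; proj₁; proj₂)
open import Data.Sum using (_⊎_; inj₁; inj₂)
open import Data.Empty using (⊥-elim)
open import Function using (_∘_; id)
open import Function.Definitions using (Injective)
open import Relation.Nullary using (yes; no; contradiction)
open import Relation.Nullary.Decidable using (decidable-stable)
open import Relation.Binary.PropositionalEquality
  using (_≡_; _≢_; refl; trans; cong; subst; module ≡-Reasoning)
  renaming (sym to ≡-sym)

lookup-injective : ∀ {A : Set} {xs : List A} → Unique xs → Injective _≡_ _≡_ (lookup xs)
lookup-injective (_ ∷ᵃ _)  {fz}   {fz}   _  = refl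
lookup-injective (x∉ ∷ᵃ _) {fz}   {fs j} eq = ⊥-elim (All.lookup x∉ (∈-lookup j) eq)
lookup-injective (x∉ ∷ᵃ _) {fs i} {fz}   eq = ⊥-elim (All.lookup x∉ (∈-lookup i) (≡-sym eq))
lookup-injective (_ ∷ᵃ uq) {fs i} {fs j} eq = cong fs (lookup-injective uq eq)

degree-≤ : ∀ {n N} (G : SimpleGraph n) (u : Fin n) (f : ∀ {w} → Adj G u w → Fin N) →
  (∀ {w w'} (a : Adj G u w) (a' : Adj G u w') → f a ≡ f a' → w ≡ w') →
  degree G u ≤ N
degree-≤ {n} G u f f-inj = injective⇒≤ {f = f ∘ adjacent} (λ eq → lookup-injective unique (f-inj _ _ eq))
  where
  neighbours : List (Fin n)
  neighbours = filter (adj? G u) (allFin n)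

  unique : Unique neighbours
  unique = filter⁺ (adj? G u) (allFin⁺ n)

  adjacent : ∀ k → Adj G u (lookup neighbours k)
  adjacent k = proj₂ (∈-filter⁻ (adj? G u) {xs = allFin n} (∈-lookup k))

join-injective : ∀ m n → Injective _≡_ _≡_ (join m n)
join-injective m n {x} {y} eq = begin
  x                      ≡⟨ ≡-sym (splitAt-join m n x) ⟩
  splitAt m (join m n x) ≡⟨ cong (splitAt m) eq ⟩
  splitAt m (join m n y) ≡⟨ splitAt-join m n y ⟩
  y                      ∎
  where open ≡-Reasoning

double-∸-3 : ∀ m → 2 * suc (suc m) ∸ 3 ≡ suc m + m
double-∸-3 m = begin
  m + suc (suc (m + 0)) ∸ 1 ≡⟨ cong (_∸ 1) (+-suc m (suc (m + 0))) ⟩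
  m + suc (m + 0)           ≡⟨ +-suc m (m + 0) ⟩
  suc (m + (m + 0))         ≡⟨ cong (suc ∘ (m +_)) (+-identityʳ m) ⟩
  suc m + m                 ∎
  where open ≡-Reasoning

IsNext-functional : ∀ {ℓ} {i j j' : Fin ℓ} → IsNext i j → IsNext i j' → j ≡ j'
IsNext-functional           (inj₁ e)       (inj₁ e')       = toℕ-injective (trans e (≡-sym e'))
IsNext-functional {j = j}   (inj₁ e)       (inj₂ (s , _))  = contradiction (toℕ<n j) (<-irrefl (trans e s))
IsNext-functional {j' = j'} (inj₂ (s , _)) (inj₁ e')       = contradiction (toℕ<n j') (<-irrefl (trans e' s))
IsNext-functional           (inj₂ (_ , z)) (inj₂ (_ , z')) = toℕ-injective (trans z (≡-sym z'))

IsNext-injective : ∀ {ℓ} {i i' j : Fin ℓ} → IsNext i j → IsNext i' j → i ≡ i'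
IsNext-injective (inj₁ e)       (inj₁ e')       = toℕ-injective (suc-injective (trans (≡-sym e) e'))
IsNext-injective (inj₁ e)       (inj₂ (_ , z))  = contradiction (trans (≡-sym z) e) 0≢1+n
IsNext-injective (inj₂ (_ , z)) (inj₁ e')       = contradiction (trans (≡-sym z) e') 0≢1+n
IsNext-injective (inj₂ (s , _)) (inj₂ (s' , _)) = toℕ-injective (suc-injective (trans s (≡-sym s')))

next : ∀ {m} → Fin (suc m) → Fin (suc m)
next {m} i with m ≟ toℕ i
... | yes _ = fz
... | no m≢i = fs (lower₁ i m≢i)

IsNext-next : ∀ {m} (i : Fin (suc m)) → IsNext i (next i)
IsNext-next {m} i with m ≟ toℕ i
... | yes m≡i = inj₂ (cong suc (≡-sym m≡i) , refl)
... | no m≢i  = inj₁ (cong suc (toℕ-lower₁ i m≢i))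

next-injective : ∀ {m} → Injective _≡_ _≡_ (next {m})
next-injective {x = i} {y = i'} eq =
  IsNext-injective (IsNext-next i) (subst (IsNext i') (≡-sym eq) (IsNext-next i'))

next-preserves-IsNext : ∀ {m} {i j : Fin (suc m)} → IsNext i j → IsNext (next i) (next j)
next-preserves-IsNext {i = i} i→j =
  subst (IsNext (next i) ∘ next) (IsNext-functional (IsNext-next i) i→j) (IsNext-next (next i))

toℕ-next : ∀ {m} (i : Fin (suc m)) → suc (toℕ i) < suc m → toℕ (next i) ≡ suc (toℕ i)
toℕ-next i lt with IsNext-next i
... | inj₁ e       = e
... | inj₂ (e , _) = contradiction lt (<-irrefl e)

rotation : ∀ {m} → ℕ → Fin (suc m) → Fin (suc m)
rotation zero    = id
rotation (suc k) = next ∘ rotation k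

toℕ-rotation : ∀ {m} k → k < suc m → toℕ (rotation {m} k fz) ≡ k
toℕ-rotation zero    _  = refl
toℕ-rotation (suc k) lt = begin
  toℕ (next (rotation k fz)) ≡⟨ toℕ-next (rotation k fz) (subst (λ x → suc x < _) (≡-sym ih) lt) ⟩
  suc (toℕ (rotation k fz))  ≡⟨ cong suc ih ⟩
  suc k                      ∎
  where
  open ≡-Reasoning
  ih : toℕ (rotation k fz) ≡ k
  ih = toℕ-rotation k (<-trans (n<1+n k) lt)

rotation-toℕ : ∀ {m} (i : Fin (suc m)) → rotation (toℕ i) fz ≡ i
rotation-toℕ i = toℕ-injective (toℕ-rotation (toℕ i) (toℕ<n i))

module _ {n} {G : SimpleGraph n} (c : EdgeColoring G) where

  Proper⇒col-injective : Proper c → ∀ {u w w'} → Adj G u w → Adj G u w' →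
    col c u w ≡ col c u w' → w ≡ w'
  Proper⇒col-injective proper {u} {w} {w'} a a' eq =
    decidable-stable (w ≟ᶠ w') (λ w≢w' → proper u w w' a a' w≢w' eq)

  pathColour : ∀ {k} → (Fin (suc k) → Fin n) → Fin k → ℕ
  pathColour p a = col c (p (inject₁ a)) (p (fs a))

  ∷-rainbowPath : ∀ {k p w} → RainbowPath c k p → Adj G w (p fz) → (∀ j → p j ≢ w) →
    (∀ a → col c w (p fz) ≢ pathColour p a) → RainbowPath c (suc k) (w ∷ p)
  ∷-rainbowPath {p = p} {w} ((p-inj , p-adj) , p-rainbow) w~p₀ w∉p fresh =
    (injective , adjacent) , rainbow
    where
    injective : Injective _≡_ _≡_ (w ∷ p)
    injective {fz}   {fz}   _  = refl
    injective {fz}   {fs j} eq = contradiction (≡-sym eq) (w∉p j)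
    injective {fs i} {fz}   eq = contradiction eq (w∉p i)
    injective {fs i} {fs j} eq = cong fs (p-inj eq)

    adjacent : ∀ a → Adj G ((w ∷ p) (inject₁ a)) ((w ∷ p) (fs a))
    adjacent fz     = w~p₀
    adjacent (fs a) = p-adj a

    rainbow : ∀ a b → a ≢ b → pathColour (w ∷ p) a ≢ pathColour (w ∷ p) b
    rainbow fz     fz     a≢b _  = a≢b refl
    rainbow fz     (fs b) _   eq = fresh b eq
    rainbow (fs a) fz     _   eq = fresh a (≡-sym eq)
    rainbow (fs a) (fs b) a≢b eq = p-rainbow a b (a≢b ∘ cong fs) eq

  rainbowCycle⇒rainbowPath : ∀ {k v} → RainbowCycle c (suc k) v → RainbowPath c k v
  rainbowCycle⇒rainbowPath (v-inj , v-adj , v-rainbow) =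
    (v-inj , λ a → v-adj _ _ (step a)) ,
    λ a b a≢b → v-rainbow _ _ _ _ (step a) (step b) (a≢b ∘ inject₁-injective)
    where
    step : ∀ {k} (a : Fin k) → IsNext (inject₁ a) (fs a)
    step a = inj₁ (cong suc (≡-sym (toℕ-inject₁ a)))

  next-rainbowCycle : ∀ {m v} → RainbowCycle c (suc m) v → RainbowCycle c (suc m) (v ∘ next)
  next-rainbowCycle (v-inj , v-adj , v-rainbow) =
    next-injective ∘ v-inj ,
    (λ i j i→j → v-adj _ _ (next-preserves-IsNext i→j)) ,
    λ i i' j j' i→i' j→j' i≢j →
      v-rainbow _ _ _ _ (next-preserves-IsNext i→i') (next-preserves-IsNext j→j') (i≢j ∘ next-injective)

  rotation-rainbowCycle : ∀ {m v} k → RainbowCycle c (suc m) v → RainbowCycle c (suc m) (v ∘ rotation k)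
  rotation-rainbowCycle zero    rc = rc
  rotation-rainbowCycle (suc k) rc = rotation-rainbowCycle k (next-rainbowCycle rc)

  module _ {m} (proper : Proper c) (noPath : NoRainbowPath c (suc (suc m)))
           {v : Fin (suc (suc m)) → Fin n} (rc : RainbowCycle c (suc (suc m)) v) where

    data Neighbour (w : Fin n) : Set where
      on-cycle  : (j : Fin (suc m)) → v (fs j) ≡ w → Neighbour w
      off-cycle : (b : Fin m) → col c w (v fz) ≡ pathColour v (fs b) → Neighbour w

    classify : ∀ {w} → Adj G (v fz) w → Neighbour w
    classify {w} v₀~w with any? (λ j → v j ≟ᶠ w)
    ... | yes (fz , v₀≡w)  = contradiction (subst (Adj G (v fz)) (≡-sym v₀≡w) v₀~w) (irrefl G)
    ... | yes (fs j , e)   = on-cycle j e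
    ... | no w∉v with any? (λ a → col c w (v fz) ≟ pathColour v a)
    ...   | yes (fs b , e) = off-cycle b e
    ...   | yes (fz , e)   = contradiction (trans (col-sym c v₀~w) e)
      (proper (v fz) w (v (fs fz)) v₀~w (proj₂ (proj₁ (rainbowCycle⇒rainbowPath rc)) fz)
        (λ w≡v₁ → w∉v (fs fz , ≡-sym w≡v₁)))
    ...   | no fresh       = contradiction
      (∷-rainbowPath (rainbowCycle⇒rainbowPath rc) (SimpleGraph.sym G v₀~w)
        (λ j vⱼ≡w → w∉v (j , vⱼ≡w)) (λ a e → fresh (a , e)))
      (noPath (w ∷ v))

    code : ∀ {w} → Neighbour w → Fin (suc m) ⊎ Fin m
    code (on-cycle j _)  = inj₁ j
    code (off-cycle b _) = inj₂ b

    code-injective : ∀ {w w'} → Adj G (v fz) w → Adj G (v fz) w' →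
      (x : Neighbour w) (y : Neighbour w') → code x ≡ code y → w ≡ w'
    code-injective _ _ (on-cycle j e) (on-cycle .j e') refl = trans (≡-sym e) e'
    code-injective v₀~w v₀~w' (off-cycle b e) (off-cycle .b e') refl =
      Proper⇒col-injective proper v₀~w v₀~w'
        (trans (col-sym c v₀~w) (trans e (trans (≡-sym e') (≡-sym (col-sym c v₀~w')))))

    degree-start-≤ : degree G (v fz) ≤ suc m + m
    degree-start-≤ = degree-≤ G (v fz) (join (suc m) m ∘ code ∘ classify)
      λ a a' → code-injective a a' (classify a) (classify a') ∘ join-injective (suc m) m

lemma6 : (ℓ : ℕ) → 3 ≤ ℓ → (n : ℕ) (G : SimpleGraph n) (c : EdgeColoring G) → Proper c → NoRainbowPath c ℓ → (v : Fin ℓ → Fin n) → RainbowCycle c ℓ v → (i : Fin ℓ) → degree G (v i) ≤ 2 * ℓ ∸ 3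
lemma6 zero () _ _ _ _ _ _ _ _
lemma6 (suc zero) (s≤s ()) _ _ _ _ _ _ _ _
lemma6 (suc (suc m)) _ n G c proper noPath v rc i = begin
  degree G (v i)                         ≡⟨ cong (degree G ∘ v) (≡-sym (rotation-toℕ i)) ⟩
  degree G (v (rotation (toℕ i) fz))     ≤⟨ degree-start-≤ c proper noPath (rotation-rainbowCycle c (toℕ i) rc) ⟩
  suc m + m                              ≡⟨ ≡-sym (double-∸-3 m) ⟩
  2 * suc (suc m) ∸ 3                    ∎
  where open ≤-Reasoning
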